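{- For every graph $G$, $c(\hat G)\le c(G)-s(G)$ and $i(\hat G)\ge i(G)$.
   Context: All graphs are finite, simple and undirected. For a graph $G$, $I(G)$ is the set of isolated vertices, $i(G)=|I(G)|$, $C(G)$ is the set (and induced subgraph) of non-isolated vertices, $c(G)=|C(G)|$. $S(G)=\{v\in C(G):\ v \text{ is adjacent to every } u\in C(G)\setminus\{v\}\}$ (the "stars"), $s(G)=|S(G)|$. $\hat G$ is defined as follows: if $C(G)$ is not a clique, $\hat G$ is the graph obtained from $G$ by deleting all vertices of $S(G)$ and their incident edges; if $C(G)$ is a clique, $\hat G$ is obtained from $G$ by replacing $C(G)$ by a single new isolated vertex. -}

module Defs where

open import Data.Nat using (ℕ; suc)
open import Data.Bool using (Bool; true; false; _∧_; _∨_; not; if_then_else_; T)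
open import Data.Fin using (Fin; zero; suc; _≟_)
open import Data.List using (List; allFin; filterᵇ; length)
open import Data.Bool.ListAction using (any; all)
open import Relation.Nullary.Decidable using (⌊_⌋)
open import Relation.Binary.PropositionalEquality using (_≡_)

-- A finite simple graph: its vertex set is the subset {v | vert v ≡ true}
-- of Fin N; edges are given by a symmetric irreflexive Boolean relation
-- (only edges between vertices of the graph are ever consulted).
record Graph (N : ℕ) : Set where
  field
    vert   : Fin N → Bool
    adj    : Fin N → Fin N → Bool
    sym    : ∀ u v → adj u v ≡ adj v u
    irrefl : ∀ v → adj v v ≡ false
open Graph public

vs : ∀ {N} → List (Fin N)
vs {N} = allFin N

_≠ᵇ_ : ∀ {N} → Fin N → Fin N → Bool
u ≠ᵇ v = not ⌊ u ≟ v ⌋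

countV : ∀ {N} → Graph N → (Fin N → Bool) → ℕ
countV G p = length (filterᵇ (λ v → vert G v ∧ p v) vs)

hasNbr : ∀ {N} → Graph N → Fin N → Bool
hasNbr G v = any (λ u → vert G u ∧ adj G v u) vs

isIsolated : ∀ {N} → Graph N → Fin N → Bool
isIsolated G v = vert G v ∧ not (hasNbr G v)

inC : ∀ {N} → Graph N → Fin N → Bool
inC G v = vert G v ∧ hasNbr G v

isStar : ∀ {N} → Graph N → Fin N → Bool
isStar G v = inC G v ∧ all (λ u → not (inC G u ∧ (u ≠ᵇ v)) ∨ adj G v u) vs

CisClique : ∀ {N} → Graph N → Bool
CisClique G = all (λ u → all (λ v → not (inC G u ∧ inC G v ∧ (u ≠ᵇ v)) ∨ adj G u v) vs) vs

i c s : ∀ {N} → Graph N → ℕ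
i G = countV G (isIsolated G)
c G = countV G (inC G)
s G = countV G (isStar G)

-- Ĝ, realised on Fin (suc N): old vertex v becomes suc v, and zero is a
-- fresh vertex used (only) as the new isolated vertex in the clique case.
hatAdj : ∀ {N} → Graph N → Fin (suc N) → Fin (suc N) → Bool
hatAdj G zero    _       = false
hatAdj G (suc u) zero    = false
hatAdj G (suc u) (suc v) = adj G u v

hatVert : ∀ {N} → Graph N → Fin (suc N) → Bool
hatVert G zero    = CisClique G
hatVert G (suc v) = if CisClique G
                    then vert G v ∧ not (inC G v)
                    else vert G v ∧ not (isStar G v)

hatSym : ∀ {N} (G : Graph N) u v → hatAdj G u v ≡ hatAdj G v u
hatSym G zero zero = _≡_.refl
hatSym G zero (suc v) = _≡_.refl
hatSym G (suc u) zero = _≡_.refl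
hatSym G (suc u) (suc v) = sym G u v

hatIrr : ∀ {N} (G : Graph N) v → hatAdj G v v ≡ false
hatIrr G zero = _≡_.refl
hatIrr G (suc v) = irrefl G v

hat : ∀ {N} → Graph N → Graph (suc N)
hat G = record { vert = hatVert G ; adj = hatAdj G ; sym = hatSym G ; irrefl = hatIrr G }

-- Ĝ has no new edges: its only new vertex is isolated, and an edge between two
-- old vertices of Ĝ is an edge of G. Hence every non-isolated vertex of Ĝ is a
-- vertex of C(G) that survived, and a surviving vertex of C(G) is not a star
-- (in the clique case none survives at all); since S(G) ⊆ C(G) this bounds
-- c(Ĝ) by |C(G) ∖ S(G)| = c(G) − s(G). Conversely an isolated vertex of G lies
-- outside C(G), so it survives, and it stays isolated in Ĝ.
module Submission where

open import Defs hiding (sym)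
open import Data.Bool using (Bool; true; false; _∧_; not; T)
open import Data.Bool.Properties using (T?; T-∧; ∧-zeroʳ)
open import Data.Empty using (⊥-elim)
open import Data.Fin using (Fin; zero; suc)
open import Data.List using (List; []; _∷_; [_]; _++_; map; tabulate; filterᵇ; length; allFin)
open import Data.List.Properties using (filter-++; filter-reject; length-++; map-tabulate)
open import Data.List.Membership.Propositional using (lose)
open import Data.List.Membership.Propositional.Properties using (∈-allFin)
open import Data.List.Relation.Binary.Sublist.Propositional using (⊆-refl)
open import Data.List.Relation.Binary.Sublist.Propositional.Properties using (filter⁺; length-mono-≤)
open import Data.List.Relation.Unary.Any using (satisfied)
open import Data.List.Relation.Unary.Any.Properties using (any⁺; any⁻)
open import Data.Nat using (ℕ; suc; _≤_; _≥_; _+_; _∸_)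
open import Data.Nat.Properties using (+-suc; m+n∸m≡n; m≤n+m; module ≤-Reasoning)
open import Data.Product using (_×_; _,_; proj₁; proj₂)
open import Function using (_∘_; id)
open import Function.Bundles using (Equivalence)
open import Relation.Binary.PropositionalEquality using (_≡_; refl; cong; sym; trans; subst; module ≡-Reasoning)
open import Relation.Nullary using (¬_)
open import Relation.Unary using (_⊆_)

open Equivalence using (to; from)

count : ∀ {A : Set} → (A → Bool) → List A → ℕ
count p xs = length (filterᵇ p xs)

module _ {A : Set} where

  count-mono : {p q : A → Bool} → T ∘ p ⊆ T ∘ q → ∀ xs → count p xs ≤ count q xs
  count-mono {p} {q} p⊆q xs =
    length-mono-≤ (filter⁺ (T? ∘ p) (T? ∘ q) (λ { refl → p⊆q }) (⊆-refl {x = xs}))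

  count-++ : (p : A → Bool) (xs ys : List A) → count p (xs ++ ys) ≡ count p xs + count p ys
  count-++ p xs ys = trans (cong length (filter-++ (T? ∘ p) xs ys)) (length-++ (filterᵇ p xs))

  count-map : ∀ {B : Set} (p : A → Bool) (f : B → A) xs → count p (map f xs) ≡ count (p ∘ f) xs
  count-map p f [] = refl
  count-map p f (x ∷ xs) with p (f x)
  ... | true  = cong suc (count-map p f xs)
  ... | false = count-map p f xs

  count-singleton-reject : (p : A → Bool) (x : A) → ¬ T (p x) → count p [ x ] ≡ 0
  count-singleton-reject p x ¬px = cong length (filter-reject (T? ∘ p) ¬px)

  count-partition : {p q : A → Bool} → T ∘ q ⊆ T ∘ p → ∀ xs →
                    count p xs ≡ count q xs + count (λ x → p x ∧ not (q x)) xs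
  count-partition q⊆p [] = refl
  count-partition {p} {q} q⊆p (x ∷ xs) with p x | q x | q⊆p {x}
  ... | true  | true  | _   = cong suc (count-partition q⊆p xs)
  ... | true  | false | _   = trans (cong suc (count-partition q⊆p xs)) (sym (+-suc _ _))
  ... | false | false | _   = count-partition q⊆p xs
  ... | false | true  | q⇒p with () ← q⇒p _

  count-difference : {p q : A → Bool} → T ∘ q ⊆ T ∘ p → ∀ xs →
                     count (λ x → p x ∧ not (q x)) xs ≡ count p xs ∸ count q xs
  count-difference {p} {q} q⊆p xs = sym (begin
    count p xs ∸ count q xs                                      ≡⟨ cong (_∸ count q xs) (count-partition q⊆p xs) ⟩
    count q xs + count (λ x → p x ∧ not (q x)) xs ∸ count q xs ≡⟨ m+n∸m≡n (count q xs) _ ⟩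
    count (λ x → p x ∧ not (q x)) xs                             ∎)
    where open ≡-Reasoning

count-allFin-suc : ∀ {n} (p : Fin (suc n) → Bool) →
                   count p (allFin (suc n)) ≡ count p [ zero ] + count (p ∘ suc) (allFin n)
count-allFin-suc {n} p = begin
  count p (zero ∷ tabulate suc)                   ≡⟨ cong (count p ∘ (zero ∷_)) (sym (map-tabulate id suc)) ⟩
  count p ([ zero ] ++ map suc (allFin n))        ≡⟨ count-++ p [ zero ] _ ⟩
  count p [ zero ] + count p (map suc (allFin n)) ≡⟨ cong (count p [ zero ] +_) (count-map p suc (allFin n)) ⟩
  count p [ zero ] + count (p ∘ suc) (allFin n)   ∎
  where open ≡-Reasoning

module _ {N : ℕ} (G : Graph N) where

  isStar⇒inC : ∀ v → T (vert G v ∧ isStar G v) → T (vert G v ∧ inC G v)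
  isStar⇒inC v with vert G v | hasNbr G v
  ... | true  | true  = _
  ... | true  | false = λ ()
  ... | false | _     = λ ()

  hatVert-suc⇒vert : ∀ v → T (hatVert G (suc v)) → T (vert G v)
  hatVert-suc⇒vert v with CisClique G | vert G v
  ... | _     | true  = _
  ... | true  | false = λ ()
  ... | false | false = λ ()

  ¬hasNbr-hat-zero : ¬ T (hasNbr (hat G) zero)
  ¬hasNbr-hat-zero nbr with w , edge ← satisfied (any⁻ _ (allFin (suc N)) nbr) =
    subst T (∧-zeroʳ (hatVert G w)) edge

  hasNbr-hat-suc⇒hasNbr : ∀ v → T (hasNbr (hat G) (suc v)) → T (hasNbr G v)
  hasNbr-hat-suc⇒hasNbr v nbr with satisfied (any⁻ _ (allFin (suc N)) nbr)
  ... | zero  , edge = ⊥-elim (subst T (∧-zeroʳ (CisClique G)) edge)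
  ... | suc w , edge with w∈Ĝ , vw ← to T-∧ edge =
    any⁺ _ (lose (∈-allFin w) (from T-∧ (hatVert-suc⇒vert w w∈Ĝ , vw)))

  hatVert-suc∧hasNbr⇒C∖S : ∀ v → T (hatVert G (suc v)) → T (hasNbr G v) →
                           T ((vert G v ∧ inC G v) ∧ not (vert G v ∧ isStar G v))
  hatVert-suc∧hasNbr⇒C∖S v with CisClique G | vert G v | hasNbr G v
  ... | true  | true  | true  = λ ()
  ... | false | true  | true  = λ v∈Ĝ _ → v∈Ĝ
  ... | _     | _     | false = λ _ ()
  ... | true  | false | true  = λ ()
  ... | false | false | true  = λ ()

  C-hat-suc⊆C∖S : ∀ v → T (hatVert G (suc v) ∧ inC (hat G) (suc v)) →
                  T ((vert G v ∧ inC G v) ∧ not (vert G v ∧ isStar G v))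
  C-hat-suc⊆C∖S v t = hatVert-suc∧hasNbr⇒C∖S v v∈Ĝ (hasNbr-hat-suc⇒hasNbr v nbr)
    where
    v∈Ĝ : T (hatVert G (suc v))
    v∈Ĝ = proj₁ (to (T-∧ {hatVert G (suc v)}) t)
    nbr : T (hasNbr (hat G) (suc v))
    nbr = proj₂ (to (T-∧ {hatVert G (suc v)}) (proj₂ (to (T-∧ {hatVert G (suc v)}) t)))

  isolated⇒hatVert-suc : ∀ v → T (vert G v ∧ isIsolated G v) → T (hatVert G (suc v))
  isolated⇒hatVert-suc v with CisClique G | vert G v | hasNbr G v
  ... | true  | true  | false = _
  ... | false | true  | false = _
  ... | _     | true  | true  = λ ()
  ... | _     | false | _     = λ ()

  isolated⇒¬hasNbr-hat-suc : ∀ v → T (vert G v ∧ isIsolated G v) → T (not (hasNbr (hat G) (suc v)))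
  isolated⇒¬hasNbr-hat-suc v
    with vert G v | hasNbr G v | hasNbr (hat G) (suc v) | hasNbr-hat-suc⇒hasNbr v
  ... | _     | _     | false | _   = _
  ... | true  | false | true  | nbr = λ _ → nbr _
  ... | true  | true  | true  | _   = λ ()
  ... | false | _     | true  | _   = λ ()

  isolated⇒isolated-hat-suc : ∀ v → T (vert G v ∧ isIsolated G v) →
                              T (hatVert G (suc v) ∧ isIsolated (hat G) (suc v))
  isolated⇒isolated-hat-suc v t =
    from T-∧ (v∈Ĝ , from T-∧ (v∈Ĝ , isolated⇒¬hasNbr-hat-suc v t))
    where
    v∈Ĝ : T (hatVert G (suc v))
    v∈Ĝ = isolated⇒hatVert-suc v t

  c-hat≤c∸s : c (hat G) ≤ c G ∸ s G
  c-hat≤c∸s = begin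
    c (hat G)                                      ≡⟨ count-allFin-suc inCĜ ⟩
    count inCĜ [ zero ] + count (inCĜ ∘ suc) vs    ≡⟨ cong (_+ count (inCĜ ∘ suc) vs) (count-singleton-reject inCĜ zero zero∉CĜ) ⟩
    count (inCĜ ∘ suc) vs                          ≤⟨ count-mono (λ {v} → C-hat-suc⊆C∖S v) vs ⟩
    count (λ v → (vert G v ∧ inC G v) ∧ not (vert G v ∧ isStar G v)) vs
                                                   ≡⟨ count-difference (λ {v} → isStar⇒inC v) vs ⟩
    c G ∸ s G                                      ∎
    where
    open ≤-Reasoning
    inCĜ : Fin (suc N) → Bool
    inCĜ u = hatVert G u ∧ inC (hat G) u
    zero∉CĜ : ¬ T (inCĜ zero)
    zero∉CĜ t = ¬hasNbr-hat-zero
      (proj₂ (to (T-∧ {CisClique G}) (proj₂ (to (T-∧ {CisClique G}) t))))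

  i≤i-hat : i G ≤ i (hat G)
  i≤i-hat = begin
    i G                                         ≤⟨ count-mono (λ {v} → isolated⇒isolated-hat-suc v) vs ⟩
    count (isoĜ ∘ suc) vs                       ≤⟨ m≤n+m _ (count isoĜ [ zero ]) ⟩
    count isoĜ [ zero ] + count (isoĜ ∘ suc) vs ≡⟨ count-allFin-suc isoĜ ⟨
    i (hat G)                                   ∎
    where
    open ≤-Reasoning
    isoĜ : Fin (suc N) → Bool
    isoĜ u = hatVert G u ∧ isIsolated (hat G) u

claim11 : ∀ {N : ℕ} (G : Graph N) → (c (hat G) ≤ c G ∸ s G) × (i (hat G) ≥ i G)
claim11 G = c-hat≤c∸s G , i≤i-hat G
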